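{- Let $n,k$ be positive integers with $n\ge 2k$ and $\gcd(n,k)=1$, let $a,b$ be the smallest positive integers with $ak=bn-1$, and let $X\in V(Q(n,k))$. Then $\chi_f(Q(n,k)\setminus\{X\})\le\frac{a}{b}$.
   Context: For a positive integer $n$ let $[n]=\{1,\dots,n\}$ and let $C_n$ be the cycle on $[n]$ with edges $\{i,i+1\}$ ($1\le i\le n-1$) and $\{n,1\}$. The Schrijver graph $\mathrm{SG}(n,k)$ ($n\ge 2k$) has as vertices the $k$-subsets of $[n]$ containing no two cyclically consecutive elements, two vertices adjacent iff they are disjoint. An arc of $C_n$ is a set $\{i,i+1,\dots,i+m-1\}$ (addition mod $n$) with $1\le m\le n-1$. A set $U\subseteq[n]$ is well-spread if for any two arcs $A,B$ with $|A|=|B|$ we have $\big||A\cap U|-|B\cap U|\big|\le 1$. $Q(n,k)$ is the induced subgraph of $\mathrm{SG}(n,k)$ on all well-spread $k$-subsets of $[n]$. $\chi_f$ is the fractional chromatic number (minimum total nonnegative weight on independent sets covering every vertex with weight at least $1$). -}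

module Defs where

open import Data.Bool using (Bool; true; false)
open import Data.Bool.Properties using () renaming (_≟_ to _≟ᵇ_)
open import Data.Nat using (ℕ; zero; suc; _+_; _*_; _∸_; _≤_; NonZero)
open import Data.Nat.DivMod using (_mod_)
open import Data.Fin using (Fin; toℕ)
open import Data.Fin.Subset using (Subset; _∈_; ∣_∣)
open import Data.Vec using (lookup)
open import Data.Vec.Properties using (≡-dec)
open import Data.List using (List; []; _∷_)
open import Data.List.Membership.Propositional using () renaming (_∈_ to _∈ₗ_)
open import Data.Product using (_×_; _,_; ∃)
open import Data.Rational using (ℚ; 0ℚ; 1ℚ) renaming (_+_ to _+ℚ_; _≤_ to _≤ℚ_)
open import Relation.Nullary using (¬_; yes; no; Dec)
import Data.List.Membership.DecPropositional
open import Relation.Binary.PropositionalEquality using (_≡_; _≢_)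

-- cyclic successor on [n] (represented as Fin n, i.e. {0,…,n-1})
next : ∀ {n} .{{_ : NonZero n}} → Fin n → Fin n
next {n} i = (suc (toℕ i)) mod n

arcCount : ∀ {n} .{{_ : NonZero n}} → Subset n → Fin n → ℕ → ℕ
arcCount U i zero = 0
arcCount {n} U i (suc m) with lookup U ((toℕ i + m) mod n)
... | true  = suc (arcCount U i m)
... | false = arcCount U i m

Stable : ∀ {n} .{{_ : NonZero n}} → Subset n → Set
Stable U = ∀ i → ¬ (i ∈ U × next i ∈ U)

WellSpread : ∀ {n} .{{_ : NonZero n}} → Subset n → Set
WellSpread {n} U = ∀ (i j : Fin n) (m : ℕ) → 1 ≤ m → m ≤ n ∸ 1 →
                   arcCount U i m ≤ arcCount U j m + 1

IsQVertex : ∀ n k .{{_ : NonZero n}} → Subset n → Set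
IsQVertex n k U = ∣ U ∣ ≡ k × Stable U × WellSpread U

Adjacent : ∀ {n} → Subset n → Subset n → Set
Adjacent {n} U V = ∀ (i : Fin n) → ¬ (i ∈ U × i ∈ V)

IsIndepQminus : ∀ n k .{{_ : NonZero n}} → Subset n → List (Subset n) → Set
IsIndepQminus n k X I =
  (∀ {U} → U ∈ₗ I → IsQVertex n k U × U ≢ X) ×
  (∀ {U V} → U ∈ₗ I → V ∈ₗ I → ¬ Adjacent U V)

_∈ₗ?_ : ∀ {n} (U : Subset n) (I : List (Subset n)) → Dec (U ∈ₗ I)
_∈ₗ?_ {n} = D._∈?_
  where module D = Data.List.Membership.DecPropositional (≡-dec {n = n} _≟ᵇ_)

coverage : ∀ {n} → Subset n → List (List (Subset n) × ℚ) → ℚ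
coverage U [] = 0ℚ
coverage U ((I , w) ∷ F) with U ∈ₗ? I
... | yes _ = w +ℚ coverage U F
... | no  _ = coverage U F

totalWeight : ∀ {n} → List (List (Subset n) × ℚ) → ℚ
totalWeight [] = 0ℚ
totalWeight ((I , w) ∷ F) = w +ℚ totalWeight F

IsFracColouring : ∀ n k .{{_ : NonZero n}} → Subset n → List (List (Subset n) × ℚ) → Set
IsFracColouring n k X F =
  (∀ {I w} → (I , w) ∈ₗ F → IsIndepQminus n k X I × 0ℚ ≤ℚ w) ×
  (∀ U → IsQVertex n k U → U ≢ X → 1ℚ ≤ℚ coverage U F)

-- χ_f(Q(n,k) \ {X}) ≤ r  (the LP minimum is attained, so this is existence of a colouring of weight ≤ r)
χf-Qminus-≤ : ∀ n k .{{_ : NonZero n}} → Subset n → ℚ → Set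
χf-Qminus-≤ n k X r = ∃ λ F → IsFracColouring n k X F × totalWeight F ≤ℚ r

{-# OPTIONS --safe #-}
module Submission where

open import Defs
open import Data.Nat using (ℕ; _+_; _*_; _≤_; _<_; NonZero)
open import Data.Nat.GCD using (gcd)
open import Data.Integer using (+_)
open import Data.Rational using (_/_)
open import Data.Fin.Subset using (Subset)
open import Data.Product using (_×_)
open import Relation.Binary.PropositionalEquality using (_≡_)

open import Data.Bool using (Bool; true; false)
import Data.Bool.Properties as Bool
open import Data.Fin as Fin using (Fin; toℕ)
open import Data.Fin.Properties
  using (toℕ-fromℕ<; fromℕ<-cong; toℕ<n; toℕ-injective; toℕ-inject₁; toℕ-fromℕ; all?; ¬∀⟶∃¬)
open import Data.Fin.Subset using (∣_∣; _∈_)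
open import Data.Fin.Subset.Properties using (_∈?_)
import Data.Integer as ℤ
import Data.Integer.Properties as ℤ
import Data.Integer.Tactic.RingSolver as ℤ
open import Data.List using (List; []; _∷_; map; _++_; filter)
open import Data.List.Membership.Propositional using () renaming (_∈_ to _∈ₗ_)
open import Data.List.Membership.Propositional.Properties using (∈-map⁺; ∈-++⁺ˡ; ∈-++⁺ʳ; ∈-filter⁺; ∈-filter⁻)
open import Data.List.Relation.Unary.Any using (here; there)
open import Data.Nat hiding (_/_)
open import Data.Nat.DivMod using (_mod_; _%_; m%n<n; m<n⇒m%n≡m; [m+n]%n≡m%n; %-distribˡ-+; m%n%n≡m%n)
open import Data.Nat.Properties
open import Algebra.Properties.CommutativeMonoid.Sum +-0-commutativeMonoid
  using (sum; sum-syntax; sum-remove; sum-cong-≗; sum-init-last; sum-replicate-zero; ∑-distrib-+)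
open import Data.Nat.Tactic.RingSolver using (solve-∀)
open import Data.Product using (_,_; ∃; proj₁; proj₂; map₂)
open import Data.Rational as ℚ using (ℚ; 0ℚ; 1ℚ; toℚᵘ)
import Data.Rational.Properties as ℚ
open import Data.Rational.Unnormalised as ℚᵘ using (mkℚᵘ) renaming (_≃_ to _≃ᵘ_)
import Data.Rational.Unnormalised.Properties as ℚᵘ
open import Data.Sum using (inj₁; inj₂)
open import Data.Vec using (lookup; []; _∷_; tabulate)
open import Data.Vec.Functional using (removeAt)
open import Data.Vec.Properties using (tabulate∘lookup; tabulate-cong; ≡-dec; lookup⇒[]=; []=⇒lookup)
open import Function using (_∘_)
open import Relation.Binary.PropositionalEquality
open import Relation.Nullary using (¬_; yes; no; contradiction; Dec)
open import Relation.Nullary.Decidable using (_×-dec_; _→-dec_; ¬?; map′)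

-- Summed over the n starting points, the arcs of length a meet X in a·k = b·n − 1 points, so some
-- arc A of length a, starting at p, meets X in fewer than b points.  Weight 1/b on each of the a
-- stars {U ≠ X : x ∈ U}, x ∈ A, has total a/b and covers U exactly |U ∩ A|/b times.  If
-- |U ∩ A| < b, then well-spreadness (the counts of arcs of one length m differ by at most 1, so each
-- lies strictly between mk/n − 1 and mk/n + 1) forces every arc of length m < n starting at p to
-- meet U in exactly ⌊mk/n⌋ points; these counts determine U, hence U = X.  Minimality of (a, b)
-- gives a < n, which keeps all arcs used proper.

sum≤* : ∀ {n} (f : Fin n → ℕ) {D} → (∀ x → f x ≤ D) → sum f ≤ n * D
sum≤* {zero}  f h = z≤n
sum≤* {suc n} f h = +-mono-≤ (h Fin.zero) (sum≤* (f ∘ Fin.suc) (h ∘ Fin.suc))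

*≤sum : ∀ {n} (f : Fin n → ℕ) {E} → (∀ x → E ≤ f x) → n * E ≤ sum f
*≤sum {zero}  f h = z≤n
*≤sum {suc n} f h = +-mono-≤ (h Fin.zero) (*≤sum (f ∘ Fin.suc) (h ∘ Fin.suc))

∑-suc : ∀ {n} (f : Fin n → ℕ) → ∑[ x < n ] suc (f x) ≡ sum f + n
∑-suc {zero}  f = refl
∑-suc {suc n} f = begin
  suc (f Fin.zero + ∑[ x < n ] suc (f (Fin.suc x)))  ≡⟨ cong (suc ∘ _+_ (f Fin.zero)) (∑-suc (f ∘ Fin.suc)) ⟩
  suc (f Fin.zero + (sum (f ∘ Fin.suc) + n))         ≡⟨ cong suc (+-assoc (f Fin.zero) _ n) ⟨
  suc (sum f + n)                                    ≡⟨ +-suc (sum f) n ⟨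
  sum f + suc n                                      ∎
  where open ≡-Reasoning

spread≤1⇒sum-bounds : ∀ {n} (c : Fin n → ℕ) → (∀ x y → c x ≤ suc (c y)) → ∀ i →
                      sum c < n * suc (c i) × n * c i < sum c + n
spread≤1⇒sum-bounds {suc n} c spread i = below , above
  where
  open ≤-Reasoning
  below : sum c < suc n * suc (c i)
  below = begin-strict
    sum c                          ≡⟨ sum-remove c ⟩
    c i + sum (removeAt c i)       ≤⟨ +-monoʳ-≤ (c i) (sum≤* (removeAt c i) (λ _ → spread _ i)) ⟩
    c i + n * suc (c i)            <⟨ n<1+n _ ⟩
    suc n * suc (c i)              ∎
  above : suc n * c i < sum c + suc n
  above = begin-strict
    suc n * c i                             <⟨ n<1+n _ ⟩
    suc (c i) + n * c i                     ≤⟨ +-monoʳ-≤ (suc (c i)) (*≤sum (removeAt c′ i) (λ _ → spread i _)) ⟩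
    suc (c i) + sum (removeAt c′ i)         ≡⟨ sum-remove c′ ⟨
    ∑[ x < suc n ] suc (c x)                ≡⟨ ∑-suc c ⟩
    sum c + suc n                           ∎
    where
    c′ : Fin (suc n) → ℕ
    c′ = suc ∘ c

∑-snoc : ∀ n (g : ℕ → ℕ) → ∑[ j < suc n ] g (toℕ j) ≡ ∑[ j < n ] g (toℕ j) + g n
∑-snoc n g = trans (sum-init-last (g ∘ toℕ))
  (cong₂ _+_ (sum-cong-≗ {n} (cong g ∘ toℕ-inject₁)) (cong g (toℕ-fromℕ n)))

∑-rotate₁ : ∀ n (g : ℕ → ℕ) → ∑[ j < n ] g (suc (toℕ j)) + g 0 ≡ ∑[ j < n ] g (toℕ j) + g n
∑-rotate₁ n g = trans (+-comm _ (g 0)) (∑-snoc n g)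

∑-periodic : ∀ n (g : ℕ → ℕ) → (∀ x → g (x + n) ≡ g x) →
             ∀ s → ∑[ j < n ] g (toℕ j + s) ≡ ∑[ j < n ] g (toℕ j)
∑-periodic n g period zero    = sum-cong-≗ {n} (cong g ∘ +-identityʳ ∘ toℕ)
∑-periodic n g period (suc s) = begin
  ∑[ j < n ] g (toℕ j + suc s)       ≡⟨ sum-cong-≗ {n} (λ j → cong g (+-suc (toℕ j) s)) ⟩
  ∑[ j < n ] g′ (suc (toℕ j))        ≡⟨ +-cancelʳ-≡ (g′ 0) _ _ rotated ⟩
  ∑[ j < n ] g′ (toℕ j)              ≡⟨ ∑-periodic n g period s ⟩
  ∑[ j < n ] g (toℕ j)               ∎
  where
  open ≡-Reasoning
  g′ : ℕ → ℕ
  g′ x = g (x + s)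
  rotated : ∑[ j < n ] g′ (suc (toℕ j)) + g′ 0 ≡ ∑[ j < n ] g′ (toℕ j) + g′ 0
  rotated = trans (∑-rotate₁ n g′)
                  (cong (_+_ (∑[ j < n ] g′ (toℕ j))) (trans (cong g (+-comm n s)) (period s)))

pigeonhole : ∀ {n} (c : Fin n → ℕ) b → sum c < n * b → ∃ λ i → c i < b
pigeonhole {n} c b ∑c<nb = map₂ ≰⇒> (¬∀⟶∃¬ n (λ i → b ≤ c i) (λ i → b ≤? c i) not-all-large)
  where
  not-all-large : ¬ (∀ i → b ≤ c i)
  not-all-large all-large = <⇒≱ ∑c<nb (*≤sum c all-large)

bit : Bool → ℕ
bit true  = 1
bit false = 0

bit-injective : ∀ {x y} → bit x ≡ bit y → x ≡ y
bit-injective {true}  {true}  _ = refl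
bit-injective {false} {false} _ = refl

∣∣≡∑bit : ∀ {n} (U : Subset n) → ∣ U ∣ ≡ ∑[ i < n ] bit (lookup U i)
∣∣≡∑bit []          = refl
∣∣≡∑bit (true ∷ U)  = cong suc (∣∣≡∑bit U)
∣∣≡∑bit (false ∷ U) = ∣∣≡∑bit U

[m%n+k]%n≡[m+k]%n : ∀ m k n .{{_ : NonZero n}} → (m % n + k) % n ≡ (m + k) % n
[m%n+k]%n≡[m+k]%n m k n = begin
  (m % n + k) % n          ≡⟨ %-distribˡ-+ (m % n) k n ⟩
  (m % n % n + k % n) % n  ≡⟨ cong (λ t → (t + k % n) % n) (m%n%n≡m%n m n) ⟩
  (m % n + k % n) % n      ≡⟨ %-distribˡ-+ m k n ⟨
  (m + k) % n              ∎
  where open ≡-Reasoning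

module Arcs {n : ℕ} .{{_ : NonZero n}} where

  position : Fin n → ℕ → Fin n
  position i m = (toℕ i + m) mod n

  indicator : Subset n → ℕ → ℕ
  indicator U x = bit (lookup U (x mod n))

  mod-cong : ∀ {x y} → x % n ≡ y % n → x mod n ≡ y mod n
  mod-cong {x} {y} eq = fromℕ<-cong _ _ eq (m%n<n x n) (m%n<n y n)

  toℕ-mod : ∀ i → toℕ i mod n ≡ i
  toℕ-mod i = toℕ-injective (trans (toℕ-fromℕ< _) (m<n⇒m%n≡m (toℕ<n i)))

  indicator-periodic : ∀ U x → indicator U (x + n) ≡ indicator U x
  indicator-periodic U x = cong (bit ∘ lookup U) (mod-cong ([m+n]%n≡m%n x n))

  indicator-%ˡ : ∀ U x y → indicator U (x % n + y) ≡ indicator U (x + y)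
  indicator-%ˡ U x y = cong (bit ∘ lookup U) (mod-cong ([m%n+k]%n≡[m+k]%n x y n))

  arcCount-suc : ∀ U i m → arcCount U i (suc m) ≡ indicator U (toℕ i + m) + arcCount U i m
  arcCount-suc U i m with lookup U ((toℕ i + m) mod n)
  ... | true  = refl
  ... | false = refl

  arcCount≡∑ : ∀ U i m → arcCount U i m ≡ ∑[ j < m ] indicator U (toℕ i + toℕ j)
  arcCount≡∑ U i zero    = refl
  arcCount≡∑ U i (suc m) = begin
    arcCount U i (suc m)               ≡⟨ arcCount-suc U i m ⟩
    g m + arcCount U i m               ≡⟨ +-comm (g m) _ ⟩
    arcCount U i m + g m               ≡⟨ cong (_+ g m) (arcCount≡∑ U i m) ⟩
    ∑[ j < m ] g (toℕ j) + g m         ≡⟨ ∑-snoc m g ⟨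
    ∑[ j < suc m ] g (toℕ j)           ∎
    where
    open ≡-Reasoning
    g : ℕ → ℕ
    g j = indicator U (toℕ i + j)

  ∑-indicator : ∀ U s → ∑[ j < n ] indicator U (toℕ j + s) ≡ ∣ U ∣
  ∑-indicator U s = begin
    ∑[ j < n ] indicator U (toℕ j + s)  ≡⟨ ∑-periodic n (indicator U) (indicator-periodic U) s ⟩
    ∑[ j < n ] indicator U (toℕ j)      ≡⟨ sum-cong-≗ {n} (cong (bit ∘ lookup U) ∘ toℕ-mod) ⟩
    ∑[ j < n ] bit (lookup U j)         ≡⟨ ∣∣≡∑bit U ⟨
    ∣ U ∣                               ∎
    where open ≡-Reasoning

  arcCount-full : ∀ U i → arcCount U i n ≡ ∣ U ∣
  arcCount-full U i = begin
    arcCount U i n                          ≡⟨ arcCount≡∑ U i n ⟩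
    ∑[ j < n ] indicator U (toℕ i + toℕ j)  ≡⟨ sum-cong-≗ {n} (cong (indicator U) ∘ +-comm (toℕ i) ∘ toℕ) ⟩
    ∑[ j < n ] indicator U (toℕ j + toℕ i)  ≡⟨ ∑-indicator U (toℕ i) ⟩
    ∣ U ∣                                   ∎
    where open ≡-Reasoning

  ∑-arcCount : ∀ U m → ∑[ i < n ] arcCount U i m ≡ m * ∣ U ∣
  ∑-arcCount U zero    = sum-replicate-zero n
  ∑-arcCount U (suc m) = begin
    ∑[ i < n ] arcCount U i (suc m)                       ≡⟨ sum-cong-≗ {n} (λ i → arcCount-suc U i m) ⟩
    ∑[ i < n ] (g i + arcCount U i m)                     ≡⟨ ∑-distrib-+ g (λ i → arcCount U i m) ⟩
    ∑[ i < n ] g i + ∑[ i < n ] arcCount U i m            ≡⟨ cong₂ _+_ (∑-indicator U m) (∑-arcCount U m) ⟩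
    ∣ U ∣ + m * ∣ U ∣                                     ∎
    where
    open ≡-Reasoning
    g : Fin n → ℕ
    g i = indicator U (toℕ i + m)

  arcCount-+ : ∀ U i m d → arcCount U i (m + d) ≡ arcCount U i m + arcCount U (position i m) d
  arcCount-+ U i m zero    = trans (cong (arcCount U i) (+-identityʳ m)) (sym (+-identityʳ _))
  arcCount-+ U i m (suc d) = begin
    arcCount U i (m + suc d)          ≡⟨ cong (arcCount U i) (+-suc m d) ⟩
    arcCount U i (suc (m + d))        ≡⟨ arcCount-suc U i (m + d) ⟩
    x + arcCount U i (m + d)          ≡⟨ cong (_+_ x) (arcCount-+ U i m d) ⟩
    x + (arcCount U i m + A)          ≡⟨ x+[y+z]≡y+[x+z] x (arcCount U i m) A ⟩
    arcCount U i m + (x + A)          ≡⟨ cong (λ t → arcCount U i m + (t + A)) shift ⟨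
    arcCount U i m + (x′ + A)         ≡⟨ cong (_+_ (arcCount U i m)) (arcCount-suc U j d) ⟨
    arcCount U i m + arcCount U j (suc d) ∎
    where
    open ≡-Reasoning
    j : Fin n
    j = position i m
    x x′ A : ℕ
    x  = indicator U (toℕ i + (m + d))
    x′ = indicator U (toℕ j + d)
    A  = arcCount U j d
    x+[y+z]≡y+[x+z] : ∀ x y z → x + (y + z) ≡ y + (x + z)
    x+[y+z]≡y+[x+z] = solve-∀
    shift : x′ ≡ x
    shift = begin
      indicator U (toℕ j + d)               ≡⟨ cong (λ t → indicator U (t + d)) (toℕ-fromℕ< _) ⟩
      indicator U ((toℕ i + m) % n + d)     ≡⟨ indicator-%ˡ U (toℕ i + m) d ⟩
      indicator U (toℕ i + m + d)           ≡⟨ cong (indicator U) (+-assoc (toℕ i) m d) ⟩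
      indicator U (toℕ i + (m + d))         ∎

  position-surjective : ∀ i q → ∃ λ m → m < n × position i m ≡ q
  position-surjective i q = m , m%n<n _ n , toℕ-injective (begin
    toℕ (position i m)                          ≡⟨ toℕ-fromℕ< _ ⟩
    (toℕ i + m) % n                             ≡⟨ cong (_% n) (+-comm (toℕ i) m) ⟩
    (m + toℕ i) % n                             ≡⟨ [m%n+k]%n≡[m+k]%n _ (toℕ i) n ⟩
    (toℕ q + (n ∸ toℕ i) + toℕ i) % n           ≡⟨ cong (_% n) (+-assoc (toℕ q) _ _) ⟩
    (toℕ q + (n ∸ toℕ i + toℕ i)) % n           ≡⟨ cong (λ t → (toℕ q + t) % n) (m∸n+n≡m (<⇒≤ (toℕ<n i))) ⟩
    (toℕ q + n) % n                             ≡⟨ [m+n]%n≡m%n (toℕ q) n ⟩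
    toℕ q % n                                   ≡⟨ m<n⇒m%n≡m (toℕ<n q) ⟩
    toℕ q                                       ∎)
    where
    open ≡-Reasoning
    -- (q − i) mod n, with n added first to avoid truncated subtraction
    m : ℕ
    m = (toℕ q + (n ∸ toℕ i)) % n

  ≡-from-arcCounts : ∀ U V p → (∀ m → m ≤ n → arcCount U p m ≡ arcCount V p m) → U ≡ V
  ≡-from-arcCounts U V p same = begin
    U                    ≡⟨ tabulate∘lookup U ⟨
    tabulate (lookup U)  ≡⟨ tabulate-cong lookup-agrees ⟩
    tabulate (lookup V)  ≡⟨ tabulate∘lookup V ⟩
    V                    ∎
    where
    open ≡-Reasoning
    lookup-agrees : ∀ q → lookup U q ≡ lookup V q
    lookup-agrees q with position-surjective p q
    ... | m , m<n , refl = bit-injective (+-cancelʳ-≡ (arcCount U p m) _ _ (begin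
      indicator U (toℕ p + m) + arcCount U p m   ≡⟨ arcCount-suc U p m ⟨
      arcCount U p (suc m)                       ≡⟨ same (suc m) m<n ⟩
      arcCount V p (suc m)                       ≡⟨ arcCount-suc V p m ⟩
      indicator V (toℕ p + m) + arcCount V p m   ≡⟨ cong (_+_ (indicator V (toℕ p + m))) (same m (<⇒≤ m<n)) ⟨
      indicator V (toℕ p + m) + arcCount U p m   ∎))

module QVertices {n k : ℕ} .{{_ : NonZero n}} where
  open Arcs

  arcCount-spread : ∀ U → IsQVertex n k U → ∀ m → m < n → ∀ x y → arcCount U x m ≤ suc (arcCount U y m)
  arcCount-spread U _                zero    _   x y = z≤n
  arcCount-spread U (_ , _ , spread) (suc m) m<n x y =
    ≤-trans (spread x y (suc m) (s≤s z≤n) (<⇒≤pred m<n)) (≤-reflexive (+-comm _ 1))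

  arcCount-bounds : ∀ U → IsQVertex n k U → ∀ i m → m < n →
                    m * k < n * suc (arcCount U i m) × n * arcCount U i m < m * k + n
  arcCount-bounds U q@(∣U∣≡k , _) i m m<n =
    subst (λ s → s < n * suc (arcCount U i m) × n * arcCount U i m < s + n) ∑≡mk
          (spread≤1⇒sum-bounds (λ j → arcCount U j m) (arcCount-spread U q m m<n) i)
    where
    ∑≡mk : ∑[ j < n ] arcCount U j m ≡ m * k
    ∑≡mk = trans (∑-arcCount U m) (cong (m *_) ∣U∣≡k)

  light-arc : ∀ {a b} → a * k + 1 ≡ b * n → ∀ X → IsQVertex n k X → ∃ λ p → arcCount X p a < b
  light-arc {a} {b} ak+1≡bn X (∣X∣≡k , _) = pigeonhole (λ i → arcCount X i a) b (begin-strict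
    ∑[ i < n ] arcCount X i a  ≡⟨ ∑-arcCount X a ⟩
    a * ∣ X ∣                  ≡⟨ cong (a *_) ∣X∣≡k ⟩
    a * k                      <⟨ m<m+n (a * k) z<s ⟩
    a * k + 1                  ≡⟨ ak+1≡bn ⟩
    b * n                      ≡⟨ *-comm b n ⟩
    n * b                      ∎)
    where open ≤-Reasoning

  module _ {a b : ℕ} (ak+1≡bn : a * k + 1 ≡ b * n) (a<n : a < n) (p : Fin n) where

    -- Compare the arc of length m with the one of length a by the arc between their ends,
    -- to which arcCount-bounds applies.
    module _ {V : Subset n} (qV : IsQVertex n k V) (Vpa<b : arcCount V p a < b) where

      floor-within : ∀ m d → m + d ≡ a → n * arcCount V p m ≤ m * k
      floor-within m d refl = +-cancelʳ-≤ (n * suc G) (n * F) (m * k) (begin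
        n * F + n * suc G       ≡⟨ *-distribˡ-+ n F (suc G) ⟨
        n * (F + suc G)         ≡⟨ cong (n *_) (+-suc F G) ⟩
        n * suc (F + G)         ≤⟨ *-monoʳ-≤ n (subst (_< b) (arcCount-+ V p m d) Vpa<b) ⟩
        n * b                   ≡⟨ *-comm n b ⟩
        b * n                   ≡⟨ ak+1≡bn ⟨
        (m + d) * k + 1         ≡⟨ regroup m d k ⟩
        m * k + suc (d * k)     ≤⟨ +-monoʳ-≤ (m * k) (proj₁ (arcCount-bounds V qV (position p m) d d<n)) ⟩
        m * k + n * suc G       ∎)
        where
        open ≤-Reasoning
        F G : ℕ
        F = arcCount V p m
        G = arcCount V (position p m) d
        d<n : d < n
        d<n = ≤-<-trans (m≤n+m d m) a<n
        regroup : ∀ m d k → (m + d) * k + 1 ≡ m * k + suc (d * k)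
        regroup = solve-∀

      floor-beyond : ∀ d → a + d < n → n * arcCount V p (a + d) ≤ (a + d) * k
      floor-beyond d a+d<n = +-cancelʳ-≤ (suc n) _ _ (begin
        n * arcCount V p (a + d) + suc n   ≡⟨ cong (λ t → n * t + suc n) (arcCount-+ V p a d) ⟩
        n * (F + C) + suc n                ≡⟨ regroup n F C ⟩
        n * suc F + suc (n * C)            ≤⟨ +-mono-≤ (*-monoʳ-≤ n Vpa<b)
                                                       (proj₂ (arcCount-bounds V qV (position p a) d d<n)) ⟩
        n * b + (d * k + n)                ≡⟨ cong (_+ (d * k + n)) (trans (*-comm n b) (sym ak+1≡bn)) ⟩
        a * k + 1 + (d * k + n)            ≡⟨ regroup′ a d k n ⟩
        (a + d) * k + suc n                ∎)
        where
        open ≤-Reasoning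
        F C : ℕ
        F = arcCount V p a
        C = arcCount V (position p a) d
        d<n : d < n
        d<n = ≤-<-trans (m≤n+m d a) a+d<n
        regroup : ∀ n F C → n * (F + C) + suc n ≡ n * suc F + suc (n * C)
        regroup = solve-∀
        regroup′ : ∀ a d k n → a * k + 1 + (d * k + n) ≡ (a + d) * k + suc n
        regroup′ = solve-∀

      arcCount-floor : ∀ m → m < n → n * arcCount V p m ≤ m * k
      arcCount-floor m m<n with m ≤? a
      ... | yes m≤a = floor-within m (a ∸ m) (m+[n∸m]≡n m≤a)
      ... | no  m≰a = subst (λ m → n * arcCount V p m ≤ m * k) a+[m∸a]≡m
                            (floor-beyond (m ∸ a) (subst (_< n) (sym a+[m∸a]≡m) m<n))
        where
        a+[m∸a]≡m : a + (m ∸ a) ≡ m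
        a+[m∸a]≡m = m+[n∸m]≡n (<⇒≤ (≰⇒> m≰a))

    arcCount-unique : ∀ {U V} → IsQVertex n k U → IsQVertex n k V →
                      arcCount U p a < b → arcCount V p a < b → U ≡ V
    arcCount-unique {U} {V} qU qV Upa<b Vpa<b = ≡-from-arcCounts U V p same
      where
      floor≤ : ∀ U V → IsQVertex n k U → IsQVertex n k V → arcCount U p a < b →
               ∀ m → m < n → arcCount U p m ≤ arcCount V p m
      floor≤ U V qU qV Upa<b m m<n = m<1+n⇒m≤n (*-cancelˡ-< n _ _ (begin-strict
        n * arcCount U p m         ≤⟨ arcCount-floor qU Upa<b m m<n ⟩
        m * k                      <⟨ proj₁ (arcCount-bounds V qV p m m<n) ⟩
        n * suc (arcCount V p m)   ∎))
        where open ≤-Reasoning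
      same : ∀ m → m ≤ n → arcCount U p m ≡ arcCount V p m
      same m m≤n with m≤n⇒m<n∨m≡n m≤n
      ... | inj₁ m<n = ≤-antisym (floor≤ U V qU qV Upa<b m m<n) (floor≤ V U qV qU Vpa<b m m<n)
      ... | inj₂ refl = trans (arcCount-full U p) (trans (proj₁ qU) (sym (trans (arcCount-full V p) (proj₁ qV))))

solution-positive : ∀ {n k} x y → 2 ≤ n → x * k + 1 ≡ y * n → 1 ≤ x × 1 ≤ y
solution-positive x       zero    _   xk+1≡0  = contradiction xk+1≡0 (m+1+n≢0 _)
solution-positive {n} zero (suc y) 2≤n 1≡n+yn =
  contradiction (≤-trans 2≤n (≤-trans (m≤m+n n (y * n)) (≤-reflexive (sym 1≡n+yn)))) λ { (s≤s ()) }
solution-positive (suc x) (suc y) _   _       = s≤s z≤n , s≤s z≤n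

solution-shift : ∀ {n k a b} → n ≤ a → a * k + 1 ≡ b * n → (a ∸ n) * k + 1 ≡ (b ∸ k) * n
solution-shift {n} {k} {a} {b} n≤a ak+1≡bn = +-cancelˡ-≡ (n * k) _ _ (begin
  n * k + ((a ∸ n) * k + 1)   ≡⟨ regroupˡ n (a ∸ n) k ⟩
  (n + (a ∸ n)) * k + 1       ≡⟨ cong (λ t → t * k + 1) (m+[n∸m]≡n n≤a) ⟩
  a * k + 1                   ≡⟨ ak+1≡bn ⟩
  b * n                       ≡⟨ cong (_* n) (m+[n∸m]≡n k≤b) ⟨
  (k + (b ∸ k)) * n           ≡⟨ regroupʳ k (b ∸ k) n ⟩
  n * k + (b ∸ k) * n         ∎)
  where
  open ≡-Reasoning
  k≤b : k ≤ b
  k≤b = <⇒≤ (*-cancelʳ-< n k b (≤-<-trans (≤-trans (≤-reflexive (*-comm k n)) (*-monoˡ-≤ k n≤a))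
                                           (subst (a * k <_) ak+1≡bn (m<m+n (a * k) z<s))))
  regroupˡ : ∀ n a′ k → n * k + (a′ * k + 1) ≡ (n + a′) * k + 1
  regroupˡ = solve-∀
  regroupʳ : ∀ k b′ n → (k + b′) * n ≡ n * k + b′ * n
  regroupʳ = solve-∀

minimal-solution-< : ∀ {n k a b} → 2 ≤ n → a * k + 1 ≡ b * n →
                     (∀ a′ b′ → 1 ≤ a′ → 1 ≤ b′ → a′ * k + 1 ≡ b′ * n → a ≤ a′ × b ≤ b′) → a < n
minimal-solution-< {n} {k} {a} {b} 2≤n ak+1≡bn minimal with n ≤? a
... | no n≰a = ≰⇒> n≰a
... | yes n≤a = contradiction (proj₁ (minimal (a ∸ n) (b ∸ k) 1≤a′ 1≤b′ shifted)) (<⇒≱ a∸n<a)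
  where
  shifted : (a ∸ n) * k + 1 ≡ (b ∸ k) * n
  shifted = solution-shift n≤a ak+1≡bn
  1≤a′ : 1 ≤ a ∸ n
  1≤a′ = proj₁ (solution-positive (a ∸ n) (b ∸ k) 2≤n shifted)
  1≤b′ : 1 ≤ b ∸ k
  1≤b′ = proj₂ (solution-positive (a ∸ n) (b ∸ k) 2≤n shifted)
  a∸n<a : a ∸ n < a
  a∸n<a = ∸-monoʳ-< (≤-trans (s≤s z≤n) 2≤n) n≤a

-- The denominator is written 1 + d, so that frac c is definitionally fromℚᵘ (mkℚᵘ (+ c) d).
module Fractions (d : ℕ) where

  frac : ℕ → ℚ
  frac c = + c / suc d

  toℚᵘ-frac : ∀ c → toℚᵘ (frac c) ≃ᵘ mkℚᵘ (+ c) d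
  toℚᵘ-frac c = ℚ.toℚᵘ-fromℚᵘ (mkℚᵘ (+ c) d)

  frac-zero : frac 0 ≡ 0ℚ
  frac-zero = ℚ.0/n≡0 (suc d)

  frac-suc : ∀ c → frac 1 ℚ.+ frac c ≡ frac (suc c)
  frac-suc c = ℚ.toℚᵘ-injective (begin
    toℚᵘ (frac 1 ℚ.+ frac c)              ≈⟨ ℚ.toℚᵘ-homo-+ (frac 1) (frac c) ⟩
    toℚᵘ (frac 1) ℚᵘ.+ toℚᵘ (frac c)      ≈⟨ ℚᵘ.+-cong (toℚᵘ-frac 1) (toℚᵘ-frac c) ⟩
    mkℚᵘ (+ 1) d ℚᵘ.+ mkℚᵘ (+ c) d        ≈⟨ ℚᵘ.*≡* (same-denominator (+ 1) (+ c) (+ suc d)) ⟩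
    mkℚᵘ (+ suc c) d                      ≈⟨ toℚᵘ-frac (suc c) ⟨
    toℚᵘ (frac (suc c))                   ∎)
    where
    open ℚᵘ.≃-Reasoning
    same-denominator : ∀ x y e → (x ℤ.* e ℤ.+ y ℤ.* e) ℤ.* e ≡ (x ℤ.+ y) ℤ.* (e ℤ.* e)
    same-denominator = ℤ.solve-∀

  0≤frac : ∀ c → 0ℚ ℚ.≤ frac c
  0≤frac c = ℚ.nonNegative⁻¹ (frac c) {{ℚ.normalize-nonNeg c (suc d)}}

  1≤frac : ∀ {c} → suc d ≤ c → 1ℚ ℚ.≤ frac c
  1≤frac {c} 1+d≤c = ℚ.toℚᵘ-cancel-≤ (ℚᵘ.≤-respʳ-≃ (ℚᵘ.≃-sym (toℚᵘ-frac c)) (ℚᵘ.*≤* 1·b≤c·1))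
    where
    1·b≤c·1 : + 1 ℤ.* + suc d ℤ.≤ + c ℤ.* + 1
    1·b≤c·1 = subst₂ ℤ._≤_ (sym (ℤ.*-identityˡ (+ suc d))) (sym (ℤ.*-identityʳ (+ c))) (ℤ.+≤+ 1+d≤c)

allSubsets : ∀ n → List (Subset n)
allSubsets zero    = [] ∷ []
allSubsets (suc n) = map (true ∷_) (allSubsets n) ++ map (false ∷_) (allSubsets n)

∈-allSubsets : ∀ {n} (U : Subset n) → U ∈ₗ allSubsets n
∈-allSubsets []          = here refl
∈-allSubsets (true ∷ U)  = ∈-++⁺ˡ (∈-map⁺ (true ∷_) (∈-allSubsets U))
∈-allSubsets (false ∷ U) = ∈-++⁺ʳ (map (true ∷_) (allSubsets _)) (∈-map⁺ (false ∷_) (∈-allSubsets U))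

coverage-∷-∈ : ∀ {n} {U : Subset n} {I} w F → U ∈ₗ I → coverage U ((I , w) ∷ F) ≡ w ℚ.+ coverage U F
coverage-∷-∈ {U = U} {I} w F U∈I with U ∈ₗ? I
... | yes _   = refl
... | no  U∉I = contradiction U∈I U∉I

coverage-∷-∉ : ∀ {n} {U : Subset n} {I} w F → ¬ U ∈ₗ I → coverage U ((I , w) ∷ F) ≡ coverage U F
coverage-∷-∉ {U = U} {I} w F U∉I with U ∈ₗ? I
... | yes U∈I = contradiction U∈I U∉I
... | no  _   = refl

isQVertex? : ∀ {n k} .{{_ : NonZero n}} U → Dec (IsQVertex n k U)
isQVertex? {n} {k} U = ∣ U ∣ ≟ k ×-dec stable? ×-dec wellSpread?
  where
  stable? : Dec (Stable U)
  stable? = all? λ i → ¬? (i ∈? U ×-dec next i ∈? U)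
  wellSpread? : Dec (WellSpread U)
  wellSpread? = all? λ i → all? λ j → map′
    (λ (h : ∀ {m} → m < n → _) m 1≤m m≤n-1 → h (m≤pred[n]⇒suc[m]≤n m≤n-1) 1≤m)
    (λ h m<n 1≤m → h _ 1≤m (<⇒≤pred m<n))
    (allUpTo? (λ m → 1 ≤? m →-dec arcCount U i m ≤? arcCount U j m + 1) n)

module Colouring {n k : ℕ} .{{_ : NonZero n}} (X : Subset n) (d : ℕ) (p : Fin n) where
  open Arcs
  open Fractions d

  Through : Fin n → Subset n → Set
  Through x U = IsQVertex n k U × U ≢ X × x ∈ U

  through? : ∀ x U → Dec (Through x U)
  through? x U = isQVertex? U ×-dec ¬? (≡-dec Bool._≟_ U X) ×-dec x ∈? U

  star : Fin n → List (Subset n)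
  star x = filter (through? x) (allSubsets n)

  ∈-star : ∀ {x U} → Through x U → U ∈ₗ star x
  ∈-star {x} {U} = ∈-filter⁺ (through? x) (∈-allSubsets U)

  star-through : ∀ {x U} → U ∈ₗ star x → Through x U
  star-through {x} = proj₂ ∘ ∈-filter⁻ (through? x) {xs = allSubsets n}

  star-∋ : ∀ {x U} → U ∈ₗ star x → x ∈ U
  star-∋ = proj₂ ∘ proj₂ ∘ star-through

  star-independent : ∀ x → IsIndepQminus n k X (star x)
  star-independent x = (λ U∈ → let qU , U≢X , _ = star-through U∈ in qU , U≢X)
                     , (λ U∈ V∈ disjoint → disjoint x (star-∋ U∈ , star-∋ V∈))

  family : ℕ → List (List (Subset n) × ℚ)
  family zero    = []
  family (suc m) = (star (position p m) , frac 1) ∷ family m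

  family-valid : ∀ m {I w} → (I , w) ∈ₗ family m → IsIndepQminus n k X I × 0ℚ ℚ.≤ w
  family-valid (suc m) (here refl) = star-independent (position p m) , 0≤frac 1
  family-valid (suc m) (there I∈) = family-valid m I∈

  totalWeight-family : ∀ m → totalWeight (family m) ≡ frac m
  totalWeight-family zero    = sym frac-zero
  totalWeight-family (suc m) = trans (cong (frac 1 ℚ.+_) (totalWeight-family m)) (frac-suc m)

  coverage-family : ∀ U → IsQVertex n k U → U ≢ X → ∀ m → coverage U (family m) ≡ frac (arcCount U p m)
  coverage-family U qU U≢X zero    = sym frac-zero
  coverage-family U qU U≢X (suc m) =
    trans (by-entry (lookup U x) refl) (cong frac (sym (arcCount-suc U p m)))
    where
    x : Fin n
    x = position p m
    by-entry : ∀ e → lookup U x ≡ e → coverage U (family (suc m)) ≡ frac (bit e + arcCount U p m)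
    by-entry true  Ux≡true  = begin
      coverage U (family (suc m))          ≡⟨ coverage-∷-∈ (frac 1) (family m) (∈-star (qU , U≢X , lookup⇒[]= x U Ux≡true)) ⟩
      frac 1 ℚ.+ coverage U (family m)     ≡⟨ cong (frac 1 ℚ.+_) (coverage-family U qU U≢X m) ⟩
      frac 1 ℚ.+ frac (arcCount U p m)     ≡⟨ frac-suc (arcCount U p m) ⟩
      frac (suc (arcCount U p m))          ∎
      where open ≡-Reasoning
    by-entry false Ux≡false = trans (coverage-∷-∉ (frac 1) (family m) x∉) (coverage-family U qU U≢X m)
      where
      x∉ : ¬ U ∈ₗ star x
      x∉ U∈ with trans (sym ([]=⇒lookup (star-∋ U∈))) Ux≡false
      ... | ()

lemma18 : (n k : ℕ) .{{_ : NonZero n}} → 1 ≤ k → 2 * k ≤ n → gcd n k ≡ 1 →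
          (a b : ℕ) .{{_ : NonZero b}} → 1 ≤ a → a * k + 1 ≡ b * n →
          (∀ (a′ b′ : ℕ) → 1 ≤ a′ → 1 ≤ b′ → a′ * k + 1 ≡ b′ * n → a ≤ a′ × b ≤ b′) →
          (X : Subset n) → IsQVertex n k X →
          χf-Qminus-≤ n k X ((+ a) / b)
lemma18 n k _   _    _ a zero    _ ak+1≡0  _       X qX = contradiction ak+1≡0 (m+1+n≢0 (a * k))
lemma18 n k 1≤k 2k≤n _ a (suc d) _ ak+1≡bn minimal X qX =
  family a , (family-valid a , covered) , ℚ.≤-reflexive (totalWeight-family a)
  where
  open QVertices {n} {k}
  open Fractions d
  a<n : a < n
  a<n = minimal-solution-< (≤-trans (*-monoʳ-≤ 2 1≤k) 2k≤n) ak+1≡bn minimal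
  light : ∃ λ p → arcCount X p a < suc d
  light = light-arc {a} {suc d} ak+1≡bn X qX
  p : Fin n
  p = proj₁ light
  open Colouring {n} {k} X d p
  covered : ∀ U → IsQVertex n k U → U ≢ X → 1ℚ ℚ.≤ coverage U (family a)
  covered U qU U≢X with suc d ≤? arcCount U p a
  ... | yes b≤Upa = subst (1ℚ ℚ.≤_) (sym (coverage-family U qU U≢X a)) (1≤frac b≤Upa)
  ... | no  b≰Upa = contradiction (arcCount-unique ak+1≡bn a<n p qU qX (≰⇒> b≰Upa) (proj₂ light)) U≢X
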